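{- Let $d$ be an even positive integer, let $G=(V,E)$ be any finite $d$-regular graph, and let $x^0\in\{ -1,1\}^V$ be any initial configuration. Define Majority Dynamics by $x^{t+1}_i=-1$ if $\sum_{j\sim i}x^t_j<0$, $x^{t+1}_i=x^t_i$ if $\sum_{j\sim i}x^t_j=0$, and $x^{t+1}_i=1$ if $\sum_{j\sim i}x^t_j>0$. Let $T$ be such that $x^{t+2}=x^t$ for all $t\ge T$, and call a vertex $i$ oscillating if $x^t_i\neq x^{t+1}_i$ for $t\ge T$. Then the subgraph of $G$ induced by the oscillating vertices has no vertex of degree exactly $1$.
   Context: It is known that Majority Dynamics on a finite graph eventually enters a cycle of length at most two, so a time $T$ with $x^{t+2}=x^t$ for all $t\ge T$ always exists; for $t\ge T$ each vertex either satisfies $x^t_i=x^{t+1}_i$ for all such $t$ or $x^t_i\ne x^{t+1}_i$ for all such $t$. -}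

module Defs where

open import Data.Nat using (ℕ; zero; suc; _+_; _*_; _≤_)
open import Data.Integer as ℤ using (ℤ; +_; -[1+_]; +[1+_])
open import Data.Fin using (Fin; zero; suc)
open import Data.Bool using (Bool; true; false; if_then_else_)
open import Data.Product using (Σ; _×_; ∃)
open import Relation.Binary.PropositionalEquality using (_≡_; _≢_)

record Graph (n : ℕ) : Set where
  field
    adj   : Fin n → Fin n → Bool
    sym   : ∀ i j → adj i j ≡ adj j i
    irrefl : ∀ i → adj i i ≡ false
open Graph public

sumℤ : (n : ℕ) → (Fin n → ℤ) → ℤ
sumℤ zero    f = + 0
sumℤ (suc n) f = f zero ℤ.+ sumℤ n (λ k → f (suc k))

sumℕ : (n : ℕ) → (Fin n → ℕ) → ℕ
sumℕ zero    f = 0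
sumℕ (suc n) f = f zero + sumℕ n (λ k → f (suc k))

degree : ∀ {n} → Graph n → Fin n → ℕ
degree {n} G i = sumℕ n (λ j → if adj G i j then 1 else 0)

Regular : ∀ {n} → Graph n → ℕ → Set
Regular G d = ∀ i → degree G i ≡ d

Even : ℕ → Set
Even d = ∃ λ k → d ≡ 2 * k

-- configuration in {-1,1}^V ; true = +1, false = -1
Config : ℕ → Set
Config n = Fin n → Bool

spin : Bool → ℤ
spin true  = + 1
spin false = -[1+ 0 ]

nbrSum : ∀ {n} → Graph n → Config n → Fin n → ℤ
nbrSum {n} G x i = sumℤ n (λ j → if adj G i j then spin (x j) else + 0)

majority : ℤ → Bool → Bool
majority (+ zero)   b = b
majority +[1+ _ ]   b = true
majority -[1+ _ ]   b = false

step : ∀ {n} → Graph n → Config n → Config n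
step G x i = majority (nbrSum G x i) (x i)

traj : ∀ {n} → Graph n → Config n → ℕ → Config n
traj G x0 zero    = x0
traj G x0 (suc t) = step G (traj G x0 t)

Oscillating : ∀ {n} → Graph n → Config n → ℕ → Fin n → Set
Oscillating G x0 T i = ∀ t → T ≤ t → traj G x0 t i ≢ traj G x0 (suc t) i

InducedDegreeOne : ∀ {n} → Graph n → (Fin n → Set) → Fin n → Set
InducedDegreeOne G P i =
  Σ _ λ j → (adj G i j ≡ true) × P j × (∀ k → adj G i k ≡ true → P k → k ≡ j)

-- Let j be the unique oscillating neighbour of an oscillating vertex i. Every
-- other neighbour of i has period 2 without oscillating, so it is frozen from
-- time T on, and the neighbour sums of i at times T and T + 1 differ only
-- through x_j, i.e. by exactly 2. A sum of d terms ±1 equals d minus twice the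
-- number of -1's, so both sums are even. But i flips at time T and flips back
-- at time T + 1, which forces the two sums to be nonzero of opposite signs,
-- hence at least 4 apart.
module Submission where

open import Defs hiding (sym)
open import Data.Bool using (Bool; true; false; not; _∧_; if_then_else_; _≟_)
open import Data.Empty using (⊥)
open import Data.Product using (_,_)
open import Data.Fin using (Fin; zero; suc)
open import Data.Fin.Properties using (suc-injective)
open import Data.Integer as ℤ using (_⊖_)
open import Data.Integer.Properties
  using (+-identityˡ; distribʳ-⊖-+-pos; distribʳ-⊖-+-neg; [1+m]⊖[1+n]≡m⊖n)
open import Data.Nat using (ℕ; zero; suc; _+_; _*_; _≤_; _<_; _≤′_; ≤′-refl; ≤′-step; z≤n; s≤s; s≤s⁻¹)
open import Data.Nat.Properties
  using (≤-refl; ≤-antisym; <-asym; <-≤-trans; +-suc; +-comm; *-suc; *-monoʳ-≤; n≤1+n; even≢odd; ≤⇒≤′; ≤′⇒≤)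
open import Function using (_∘_)
open import Relation.Binary.PropositionalEquality
  using (_≡_; _≢_; _≗_; refl; sym; trans; cong; cong₂; subst; module ≡-Reasoning)
open import Relation.Nullary using (¬_)
open import Relation.Nullary.Decidable using (decidable-stable)

count : ∀ {n} → (Fin n → Bool) → ℕ
count {n} p = sumℕ n (λ j → if p j then 1 else 0)

count-cong : ∀ {n} {p q : Fin n → Bool} → p ≗ q → count p ≡ count q
count-cong {zero}  p≗q = refl
count-cong {suc n} p≗q =
  cong₂ _+_ (cong (λ b → if b then 1 else 0) (p≗q zero)) (count-cong (p≗q ∘ suc))

count-flip : ∀ {n} (p q : Fin n → Bool) (j : Fin n) → (∀ k → k ≢ j → p k ≡ q k) →
             p j ≡ true → q j ≡ false → count p ≡ suc (count q)
count-flip p q zero agree pj qj rewrite pj | qj =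
  cong suc (count-cong (λ k → agree (suc k) λ ()))
count-flip p q (suc j) agree pj qj rewrite agree zero (λ ()) =
  trans (cong (_ +_) (count-flip (p ∘ suc) (q ∘ suc) j agree′ pj qj)) (+-suc _ _)
  where
  agree′ : ∀ k → k ≢ j → p (suc k) ≡ q (suc k)
  agree′ k k≢j = agree (suc k) (k≢j ∘ suc-injective)

sumℤ-spin : ∀ {n} (h x : Fin n → Bool) →
            sumℤ n (λ j → if h j then spin (x j) else ℤ.+ 0) ≡
            count h ⊖ 2 * count (λ j → h j ∧ not (x j))
sumℤ-spin {zero}  h x = refl
sumℤ-spin {suc n} h x
  with h zero | x zero | count (h ∘ suc) | count (λ j → h (suc j) ∧ not (x (suc j)))
     | sumℤ-spin (h ∘ suc) (x ∘ suc)
... | false | _     | _   | _   | ih = trans (+-identityˡ _) ih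
... | true  | true  | deg | neg | ih =
  trans (cong (ℤ._+_ (spin true)) ih) (distribʳ-⊖-+-pos 1 deg (2 * neg))
... | true  | false | deg | neg | ih = begin
  spin false ℤ.+ sumℤ n _          ≡⟨ cong (ℤ._+_ (spin false)) ih ⟩
  spin false ℤ.+ (deg ⊖ 2 * neg)   ≡⟨ distribʳ-⊖-+-neg 0 deg (2 * neg) ⟩
  deg ⊖ suc (2 * neg)              ≡⟨ [1+m]⊖[1+n]≡m⊖n deg (suc (2 * neg)) ⟨
  suc deg ⊖ suc (suc (2 * neg))    ≡⟨ cong (suc deg ⊖_) (*-suc 2 neg) ⟨
  suc deg ⊖ 2 * suc neg            ∎
  where open ≡-Reasoning

majority-⊖-up : ∀ m n → majority (m ⊖ n) false ≡ true → n < m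
majority-⊖-up zero    zero    ()
majority-⊖-up zero    (suc n) ()
majority-⊖-up (suc m) zero    _  = s≤s z≤n
majority-⊖-up (suc m) (suc n) up =
  s≤s (majority-⊖-up m n (subst (λ s → majority s false ≡ true) ([1+m]⊖[1+n]≡m⊖n m n) up))

majority-⊖-down : ∀ m n → majority (m ⊖ n) true ≡ false → m < n
majority-⊖-down zero    zero    ()
majority-⊖-down zero    (suc n) _    = s≤s z≤n
majority-⊖-down (suc m) zero    ()
majority-⊖-down (suc m) (suc n) down =
  s≤s (majority-⊖-down m n (subst (λ s → majority s true ≡ false) ([1+m]⊖[1+n]≡m⊖n m n) down))

majority-cannot-return : ∀ k N {u v} → u ≢ v →
                         majority (2 * k ⊖ 2 * N) u ≡ v →
                         majority (2 * k ⊖ 2 * suc N) v ≡ u → ⊥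
majority-cannot-return k N {true}  {true}  u≢v _ _ = u≢v refl
majority-cannot-return k N {false} {false} u≢v _ _ = u≢v refl
majority-cannot-return k N {false} {true}  _ there back =
  even≢odd k N (≤-antisym (s≤s⁻¹ 2k<2N+2) (majority-⊖-up (2 * k) (2 * N) there))
  where
  2k<2N+2 : 2 * k < suc (suc (2 * N))
  2k<2N+2 = subst (2 * k <_) (*-suc 2 N) (majority-⊖-down (2 * k) (2 * suc N) back)
majority-cannot-return k N {true}  {false} _ there back =
  <-asym (majority-⊖-up (2 * k) (2 * suc N) back)
         (<-≤-trans (majority-⊖-down (2 * k) (2 * N) there) (*-monoʳ-≤ 2 (n≤1+n N)))

negNbrs : ∀ {n} → Graph n → Config n → Fin n → ℕ
negNbrs G x i = count (λ j → adj G i j ∧ not (x j))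

AgreeOnNbrsExcept : ∀ {n} → Graph n → Fin n → Fin n → Config n → Config n → Set
AgreeOnNbrsExcept G i j x y = ∀ l → adj G i l ≡ true → l ≢ j → x l ≡ y l

negNbrs-flip : ∀ {n} (G : Graph n) {i j : Fin n} {x y : Config n} →
               adj G i j ≡ true → AgreeOnNbrsExcept G i j x y → x j ≡ true → y j ≡ false →
               negNbrs G y i ≡ suc (negNbrs G x i)
negNbrs-flip G {i} {j} {x} {y} i~j agree xj yj =
  count-flip _ _ j agree′ (cong₂ _∧_ i~j (cong not yj)) (cong₂ _∧_ i~j (cong not xj))
  where
  agree′ : ∀ l → l ≢ j → adj G i l ∧ not (y l) ≡ adj G i l ∧ not (x l)
  agree′ l l≢j with adj G i l in i~l
  ... | true  = cong not (sym (agree l i~l l≢j))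
  ... | false = refl

majority-cannot-return-oriented :
  ∀ {n} (G : Graph n) k {i j : Fin n} {x y : Config n} {u v : Bool} →
  degree G i ≡ 2 * k → adj G i j ≡ true → AgreeOnNbrsExcept G i j x y →
  x j ≡ true → y j ≡ false → u ≢ v →
  majority (nbrSum G x i) u ≡ v → majority (nbrSum G y i) v ≡ u → ⊥
majority-cannot-return-oriented G k {i} {j} {x} {y} {u} {v} deg i~j agree xj yj u≢v there back =
  majority-cannot-return k (negNbrs G x i) u≢v
    (subst (λ s → majority s u ≡ v) sumˣ there)
    (subst (λ s → majority s v ≡ u) sumʸ back)
  where
  sumˣ : nbrSum G x i ≡ 2 * k ⊖ 2 * negNbrs G x i
  sumˣ = trans (sumℤ-spin (adj G i) x) (cong (_⊖ 2 * negNbrs G x i) deg)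
  sumʸ : nbrSum G y i ≡ 2 * k ⊖ 2 * suc (negNbrs G x i)
  sumʸ = trans (sumℤ-spin (adj G i) y)
               (cong₂ (λ d m → d ⊖ 2 * m) deg (negNbrs-flip G i~j agree xj yj))

majority-cannot-return-after-one-change :
  ∀ {n} (G : Graph n) k {i j : Fin n} {x y : Config n} {u v : Bool} →
  degree G i ≡ 2 * k → adj G i j ≡ true → AgreeOnNbrsExcept G i j x y →
  x j ≢ y j → u ≢ v →
  majority (nbrSum G x i) u ≡ v → majority (nbrSum G y i) v ≡ u → ⊥
majority-cannot-return-after-one-change G k {j = j} {x} {y} deg i~j agree xj≢yj u≢v there back
  with x j in xj | y j in yj
... | true  | true  = xj≢yj refl
... | false | false = xj≢yj refl
... | true  | false =
  majority-cannot-return-oriented G k deg i~j agree xj yj u≢v there back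
... | false | true  =
  majority-cannot-return-oriented G k deg i~j (λ l i~l l≢j → sym (agree l i~l l≢j))
    yj xj (u≢v ∘ sym) back there

period2-alternating : ∀ {A : Set} (f : ℕ → A) T → (∀ t → T ≤ t → f (t + 2) ≡ f t) →
                      f T ≢ f (suc T) → ∀ t → T ≤ t → f t ≢ f (suc t)
period2-alternating f T period fT≢fT+1 t T≤t = alternates (≤⇒≤′ T≤t)
  where
  alternates : ∀ {t} → T ≤′ t → f t ≢ f (suc t)
  alternates ≤′-refl = fT≢fT+1
  alternates (≤′-step {t} T≤′t) ft+1≡ft+2 =
    alternates T≤′t (sym (trans ft+1≡ft+2 (trans (cong f (+-comm 2 t)) (period t (≤′⇒≤ T≤′t)))))

mainTheorem3 : (d : ℕ) → 0 < d → Even d →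
    (n : ℕ) (G : Graph n) → Regular G d →
    (x0 : Config n) (T : ℕ) →
    (∀ t → T ≤ t → ∀ i → traj G x0 (t + 2) i ≡ traj G x0 t i) →
    (i : Fin n) → Oscillating G x0 T i →
    ¬ InducedDegreeOne G (Oscillating G x0 T) i
mainTheorem3 d _ (k , d≡2k) n G regular x0 T period i osc-i (j , i~j , osc-j , unique) =
  majority-cannot-return-after-one-change G k (trans (regular i) d≡2k) i~j frozen
    (osc-j T ≤-refl) (osc-i T ≤-refl) refl returns
  where
  x : ℕ → Config n
  x = traj G x0
  returns : x (2 + T) i ≡ x T i
  returns = trans (cong (λ t → x t i) (+-comm 2 T)) (period T ≤-refl i)
  frozen : AgreeOnNbrsExcept G i j (x T) (x (suc T))
  frozen l i~l l≢j = decidable-stable (x T l ≟ x (suc T) l) λ moves →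
    l≢j (unique l i~l (period2-alternating (λ t → x t l) T (λ t T≤t → period t T≤t l) moves))
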